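{- $R_{3}(L)\leq 2593$. That is, for every $3$-coloring of the lattice grid $[2593]\times[2593]$ there exist integers $i,j$ and $t\geq 1$ such that the three points $(i,j)$, $(i,j+t)$, $(i+t,j+t)$ all lie in the grid and all receive the same color.
   Context: For $n\in\mathbb{N}$, $[n]=\{1,\dots,n\}$. A $c$-coloring of the grid $[n]\times[n]$ is a function $[n]\times[n]\to[c]$. An $L$ in the grid is a set of three lattice points of the form $\{(i,j),(i,j+t),(i+t,j+t)\}$ with $t$ a positive integer (a right isosceles triangle formed by three corners of an axis-parallel square). For a positive integer $c$, $R_c(L)$ denotes the least $n$ such that every $c$-coloring of $[n]\times[n]$ contains a monochromatic $L$ (such $n$ is known to exist). -}

module Defs where

open import Data.Nat using (ℕ; _+_; _<_; _≤_)
open import Data.Fin using (Fin)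
open import Data.Product using (_×_; ∃-syntax)
open import Relation.Binary.PropositionalEquality using (_≡_)

-- The grid [n] × [n] = {1..n}² is encoded by 0-based ℕ coordinates (i, j)
-- with i < n, j < n (coordinate k stands for the point k+1 of [n]); L-patterns
-- are translation invariant, so this shift is harmless.
-- A c-coloring assigns a colour in Fin c (= [c]) to each point.  It is given as
-- a function on ℕ × ℕ; only its values on the grid are ever inspected, and every
-- coloring of the grid extends to such a function, so this is the same notion.
Coloring : ℕ → Set
Coloring c = ℕ → ℕ → Fin c

-- Some L {(i,j),(i,j+t),(i+t,j+t)} with t ≥ 1, all three points in the grid,
-- is monochromatic.  (i+t<n and j+t<n imply all three points lie in the grid.)
MonoL : (n c : ℕ) → Coloring c → Set
MonoL n c χ =
  ∃[ i ] ∃[ j ] ∃[ t ]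
    (1 ≤ t × i + t < n × j + t < n ×
     χ i j ≡ χ i (j + t) × χ i (j + t) ≡ χ (i + t) (j + t))

EveryColoringHasMonoL : (n c : ℕ) → Set
EveryColoringHasMonoL n c = (χ : Coloring c) → MonoL n c χ

-- Among the 2593 diagonal points (x, x) some colour c occurs 865 times, and
-- among the C(865,2) pairs of them some gap p occurs 145 times.  The corner
-- (x, x + p) of such a pair avoids c, since it would close an L on the diagonal,
-- so 73 of these corners share a colour c' ≠ c.  Among the C(73,2) pairs of their
-- left ends x a second gap d repeats, at a, a + d and b, b + d with a < b.  Each
-- of (a, b + p), (a, b + p + d), (a + d, b + p + d) closes an L with the squares
-- at two of these left ends unless it avoids both c and c'.  So all three carry
-- the third colour, and they form an L.

module Submission where

open import Defs
open import Data.Bool using (true; false)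
open import Data.Fin using (Fin; zero; suc; punchOut)
open import Data.Fin.Properties using (punchOut-injective) renaming (_≟_ to _≟ᶠ_)
open import Data.List using (List; []; _∷_; length; map; filter; _++_; upTo; allFin)
open import Data.List.Properties using (length-++; length-map; length-upTo)
open import Data.List.Membership.Propositional using (_∈_)
open import Data.List.Membership.Propositional.Properties
  using (∈-upTo⁺; ∈-allFin; ∈-filter⁺; ∈-filter⁻)
open import Data.List.Relation.Binary.Sublist.Propositional.Properties
  using (filter-⊆; filter⁺; length-mono-≤)
open import Data.List.Relation.Unary.All as All using (All; []; _∷_)
open import Data.List.Relation.Unary.All.Properties as All
  using (all-filter; all-upTo; ¬Any⇒All¬)
open import Data.List.Relation.Unary.AllPairs as AllPairs using (AllPairs; []; _∷_)
import Data.List.Relation.Unary.AllPairs.Properties as AllPairs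
open import Data.List.Relation.Unary.Any using (here; there; any?)
open import Data.Nat using (ℕ; zero; suc; _+_; _*_; _∸_; _≤_; _<_; s≤s; z≤n; _<?_)
  renaming (_≟_ to _≟ⁿ_)
open import Data.Nat.Combinatorics using (_C_; nC1≡n; nCk+nC[k+1]≡[n+1]C[k+1])
open import Data.Nat.Properties
open import Algebra.Properties.CommutativeSemigroup +-commutativeSemigroup
  using (xy∙z≈xz∙y)
open import Data.Product using (∃-syntax; _×_; _,_; proj₁; proj₂; uncurry)
open import Data.Product.Relation.Binary.Lex.Strict using (×-Lex)
open import Data.Sum using (_⊎_; inj₁; inj₂)
open import Function using (_∘_; id)
open import Relation.Binary.Definitions using (DecidableEquality)
open import Relation.Binary.PropositionalEquality
open import Relation.Nullary using (Dec; does; yes; no; contradiction)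
open import Relation.Unary.Properties using (∁?)

module _ {A : Set} where

  pairs : List A → List (A × A)
  pairs []       = []
  pairs (x ∷ xs) = map (x ,_) xs ++ pairs xs

  All-pairs : ∀ {P : A → Set} {R : A → A → Set} {xs} → All P xs → AllPairs R xs →
              All (uncurry λ x y → P x × P y × R x y) (pairs xs)
  All-pairs [] [] = []
  All-pairs {xs = x ∷ xs} (px ∷ pxs) (rx ∷ rxs) =
    All.++⁺ (All.map⁺ (All.zipWith (λ (py , r) → px , py , r) (pxs , rx)))
            (All-pairs pxs rxs)

  AllPairs-pairs : ∀ {R : A → A → Set} {xs} → AllPairs R xs →
                   AllPairs (×-Lex _≡_ R R) (pairs xs)
  AllPairs-pairs [] = []
  AllPairs-pairs {R} {x ∷ xs} (rx ∷ rxs) =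
    AllPairs.++⁺ (AllPairs.map⁺ (AllPairs.map (λ r → inj₂ (refl , r)) rxs))
                 (AllPairs-pairs rxs)
                 (All.map⁺ (All.map (λ _ → All.map (λ (r , _) → inj₁ r) x<pairs) rx))
    where
    x<pairs : All (uncurry λ y z → R x y × R x z × R y z) (pairs xs)
    x<pairs = All-pairs rx rxs

  C2≤length-pairs : ∀ {k} xs → k ≤ length xs → k C 2 ≤ length (pairs xs)
  C2≤length-pairs {zero}  xs       _         = z≤n
  C2≤length-pairs {suc k} (x ∷ xs) (s≤s k≤) = begin
    suc k C 2                           ≡⟨ sym (nCk+nC[k+1]≡[n+1]C[k+1] k 1) ⟩
    k C 1 + k C 2                       ≡⟨ cong (_+ k C 2) (nC1≡n k) ⟩
    k + k C 2                           ≤⟨ +-mono-≤ k≤ (C2≤length-pairs xs k≤) ⟩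
    length xs + length (pairs xs)       ≡⟨ cong (_+ _) (sym (length-map (x ,_) xs)) ⟩
    length (map (x ,_) xs) + length (pairs xs) ≡⟨ sym (length-++ (map (x ,_) xs)) ⟩
    length (pairs (x ∷ xs))             ∎
    where open ≤-Reasoning

  length-filter-∁ : ∀ {P : A → Set} (P? : ∀ x → Dec (P x)) xs →
                    length (filter P? xs) + length (filter (∁? P?) xs) ≡ length xs
  length-filter-∁ P? [] = refl
  length-filter-∁ P? (x ∷ xs) with does (P? x)
  ... | true  = cong suc (length-filter-∁ P? xs)
  ... | false = trans (+-suc _ _) (cong suc (length-filter-∁ P? xs))

  AllPairs-strengthen : ∀ {P : A → Set} {R S : A → A → Set} →
                        (∀ {x y} → P x → P y → R x y → S x y) →
                        ∀ {xs} → All P xs → AllPairs R xs → AllPairs S xs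
  AllPairs-strengthen f [] [] = []
  AllPairs-strengthen f (px ∷ pxs) (rx ∷ rxs) =
    All.zipWith (λ (py , r) → f px py r) (pxs , rx) ∷ AllPairs-strengthen f pxs rxs

module _ {A B : Set} (_≟_ : DecidableEquality B) (f : A → B) where

  fibre : B → List A → List A
  fibre v = filter (λ x → f x ≟ v)

  All-fibre⁺ : ∀ {Q : A → Set} {v xs} → All Q xs → All (λ x → Q x × f x ≡ v) (fibre v xs)
  All-fibre⁺ {v = v} {xs} Qxs =
    All.zip (All.filter⁺ (λ x → f x ≟ v) Qxs , all-filter (λ x → f x ≟ v) xs)

  AllPairs-fibre⁺ : ∀ {R : A → A → Set} {v xs} → AllPairs R xs → AllPairs R (fibre v xs)
  AllPairs-fibre⁺ {v = v} = AllPairs.filter⁺ (λ x → f x ≟ v)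

  pigeonhole : ∀ {m} vs {xs} → All (λ x → f x ∈ vs) xs → length vs * m < length xs →
               ∃[ v ] v ∈ vs × m < length (fibre v xs)
  pigeonhole []       {x ∷ _} (() ∷ _) _
  pigeonhole {m} (v ∷ vs) {xs} f∈ m+vs*m<xs with m <? length (fibre v xs)
  ... | yes m<fibre = v , here refl , m<fibre
  ... | no  m≮fibre =
    let (w , w∈vs , m<fibre-rest) = pigeonhole vs f∈vs vs*m<rest
    in  w , there w∈vs
          , <-≤-trans m<fibre-rest (length-mono-≤ (filter⁺ _ _ (λ { refl → id }) (filter-⊆ _ xs)))
    where
    rest : List A
    rest = filter (∁? (λ x → f x ≟ v)) xs
    f∈vs : All (λ x → f x ∈ vs) rest
    f∈vs = All.zipWith (λ { (here fx≡v , fx≢v) → contradiction fx≡v fx≢v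
                          ; (there ∈vs  , _)    → ∈vs })
                       (All.filter⁺ _ f∈ , all-filter _ xs)
    vs*m<rest : length vs * m < length rest
    vs*m<rest = +-cancelˡ-< m _ _ (begin-strict
      m + length vs * m                        <⟨ m+vs*m<xs ⟩
      length xs                                ≡⟨ sym (length-filter-∁ _ xs) ⟩
      length (fibre v xs) + length rest        ≤⟨ +-monoˡ-≤ _ (≮⇒≥ m≮fibre) ⟩
      m + length rest                          ∎)
      where open ≤-Reasoning

n≡m+[n∸m] : ∀ {m n} → m ≤ n → n ≡ m + (n ∸ m)
n≡m+[n∸m] = sym ∘ m+[n∸m]≡n

×-Lex-equal-gap⇒< : ∀ {d x y x' y'} → y ≡ x + d → y' ≡ x' + d →
                    ×-Lex _≡_ _<_ _<_ (x , y) (x' , y') → x < x'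
×-Lex-equal-gap⇒< _    _    (inj₁ x<x')         = x<x'
×-Lex-equal-gap⇒< refl refl (inj₂ (refl , y<y')) = contradiction y<y' (<-irrefl refl)

repeated-gap : ∀ {P : ℕ → Set} {n m xs} k → (∀ {x} → P x → x < n) →
               AllPairs _<_ xs → All P xs → k ≤ length xs → n * m < k C 2 →
               ∃[ d ] ∃[ ys ] AllPairs _<_ ys × All (λ x → P x × P (x + suc d)) ys ×
                             m < length ys
repeated-gap {P} {n} {m} {xs} k bound sorted Pxs k≤xs nm<kC2 =
  let (d , _ , m<same-gap) = pigeonhole _≟ⁿ_ gap (upTo n) gap∈upTo count
      same-gap = fibre _≟ⁿ_ gap d (pairs xs)
      shape : All (uncurry λ x y → P x × P y × y ≡ x + suc d) same-gap
      shape = All.map (λ ((Px , Py , x<y) , gap≡d) → Px , Py , gap-spec x<y gap≡d)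
                      (All-fibre⁺ _≟ⁿ_ gap pairs-ok)
  in  d , map proj₁ same-gap
        , AllPairs.map⁺ (AllPairs-strengthen (λ (_ , _ , e) (_ , _ , e′) → ×-Lex-equal-gap⇒< e e′)
            shape (AllPairs-fibre⁺ _≟ⁿ_ gap (AllPairs-pairs sorted)))
        , All.map⁺ (All.map (λ { (Px , Py , refl) → Px , Py }) shape)
        , subst (m <_) (sym (length-map proj₁ same-gap)) m<same-gap
  where
  gap : ℕ × ℕ → ℕ
  gap (x , y) = y ∸ suc x

  gap-spec : ∀ {x y d} → x < y → gap (x , y) ≡ d → y ≡ x + suc d
  gap-spec {x} x<y refl = trans (n≡m+[n∸m] x<y) (sym (+-suc x _))

  pairs-ok : All (uncurry λ x y → P x × P y × x < y) (pairs xs)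
  pairs-ok = All-pairs Pxs sorted

  gap∈upTo : All (λ e → gap e ∈ upTo n) (pairs xs)
  gap∈upTo = All.map (λ { {x , y} (_ , Py , _) →
                             ∈-upTo⁺ (≤-<-trans (m∸n≤m y (suc x)) (bound Py)) })
                     pairs-ok

  count : length (upTo n) * m < length (pairs xs)
  count = subst (λ l → l * m < length (pairs xs)) (sym (length-upTo n))
                (<-≤-trans nm<kC2 (C2≤length-pairs xs k≤xs))

others : Fin 3 → List (Fin 3)
others c = filter (∁? (_≟ᶠ c)) (allFin 3)

length-others : ∀ c → length (others c) ≡ 2
length-others zero             = refl
length-others (suc zero)       = refl
length-others (suc (suc zero)) = refl

∈-others⁺ : ∀ {c v} → v ≢ c → v ∈ others c
∈-others⁺ {c} {v} = ∈-filter⁺ (∁? (_≟ᶠ c)) (∈-allFin v)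

∈-others⁻ : ∀ {c v} → v ∈ others c → v ≢ c
∈-others⁻ {c} = proj₂ ∘ ∈-filter⁻ (∁? (_≟ᶠ c)) {xs = allFin 3}

≢-both⇒≡ : ∀ {x y z : Fin 2} → x ≢ z → y ≢ z → x ≡ y
≢-both⇒≡ {zero}     {zero}                  _   _   = refl
≢-both⇒≡ {suc zero} {suc zero}              _   _   = refl
≢-both⇒≡ {zero}     {suc zero} {zero}       x≢z _   = contradiction refl x≢z
≢-both⇒≡ {zero}     {suc zero} {suc zero}   _   y≢z = contradiction refl y≢z
≢-both⇒≡ {suc zero} {zero}     {zero}       _   y≢z = contradiction refl y≢z
≢-both⇒≡ {suc zero} {zero}     {suc zero}   x≢z _   = contradiction refl x≢z

-- Removing c identifies the colours other than c with Fin 2.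
third-colour : ∀ {c c' u v : Fin 3} → c' ≢ c → u ≢ c → u ≢ c' → v ≢ c → v ≢ c' → u ≡ v
third-colour c'≢c u≢c u≢c' v≢c v≢c' =
  punchOut-injective (≢-sym u≢c) (≢-sym v≢c)
    (≢-both⇒≡ (u≢c' ∘ punchOut-injective _ (≢-sym c'≢c))
              (v≢c' ∘ punchOut-injective _ (≢-sym c'≢c)))

module Grid {n k : ℕ} (χ : Coloring k) where

  monoL : ∀ {i j i' j'} t → 1 ≤ t → i' ≡ i + t → j' ≡ j + t → i' < n → j' < n →
          χ i j ≡ χ i j' → χ i j' ≡ χ i' j' → MonoL n k χ
  monoL {i} {j} t 1≤t refl refl i'<n j'<n e e' = i , j , t , 1≤t , i'<n , j'<n , e , e'

  monoL-diagonal : ∀ {x y} → x < y → y < n → χ x x ≡ χ x y → χ x y ≡ χ y y → MonoL n k χ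
  monoL-diagonal {x} {y} x<y y<n =
    monoL (y ∸ x) (m<n⇒0<n∸m x<y) (n≡m+[n∸m] (<⇒≤ x<y)) (n≡m+[n∸m] (<⇒≤ x<y)) y<n y<n

  Diagonal : Fin k → ℕ → Set
  Diagonal c x = x < n × χ x x ≡ c

  Square : Fin k → Fin k → ℕ → ℕ → Set
  Square c c' p x = Diagonal c x × Diagonal c (x + p) × χ x (x + p) ≡ c'

  -- (x, y + p) closes an L with (x, x) and (y + p, y + p), and one with (x, x + p) and (y, y + p).
  corner-colour : ∀ {c c' p x y} → Square c c' p x → Square c c' p y → x < y →
                  MonoL n k χ ⊎ (χ x (y + p) ≢ c × χ x (y + p) ≢ c')
  corner-colour {c} {c'} {p} {x} {y} ((_ , x↘) , _ , x↗) ((y<n , _) , (y+p<n , y+p↘) , y↗) x<y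
    with χ x (y + p) ≟ᶠ c | χ x (y + p) ≟ᶠ c'
  ... | yes ≡c | _       = inj₁ (monoL-diagonal (<-≤-trans x<y (m≤m+n y p)) y+p<n
                                  (trans x↘ (sym ≡c)) (trans ≡c (sym y+p↘)))
  ... | no _   | yes ≡c' = inj₁ (monoL (y ∸ x) (m<n⇒0<n∸m x<y) y≡x+[y∸x]
                                  (trans (cong (_+ p) y≡x+[y∸x]) (xy∙z≈xz∙y x _ p)) y<n y+p<n
                                  (trans x↗ (sym ≡c')) (trans ≡c' (sym y↗)))
    where
    y≡x+[y∸x] : y ≡ x + (y ∸ x)
    y≡x+[y∸x] = n≡m+[n∸m] (<⇒≤ x<y)
  ... | no ≢c  | no ≢c'  = inj₂ (≢c , ≢c')

module Grid₃ {n : ℕ} (χ : Coloring 3) where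
  open Grid {n} χ

  four-squares⇒monoL : ∀ {c c' p a b t} → c' ≢ c → 1 ≤ t → a < b →
                       Square c c' p a → Square c c' p (a + t) →
                       Square c c' p b → Square c c' p (b + t) → MonoL n 3 χ
  four-squares⇒monoL {p = p} {a} {b} {t} c'≢c 1≤t a<b sa sa+t sb sb+t
    with corner-colour sa sb a<b
       | corner-colour sa sb+t (<-≤-trans a<b (m≤m+n b t))
       | corner-colour sa+t sb+t (+-monoˡ-< t a<b)
  ... | inj₁ L | _      | _      = L
  ... | _      | inj₁ L | _      = L
  ... | _      | _      | inj₁ L = L
  ... | inj₂ (u≢c , u≢c') | inj₂ (v≢c , v≢c') | inj₂ (w≢c , w≢c') =
    monoL t 1≤t refl (xy∙z≈xz∙y b t p) (proj₁ (proj₁ sa+t)) (proj₁ (proj₁ (proj₂ sb+t)))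
      (third-colour c'≢c u≢c u≢c' v≢c v≢c') (third-colour c'≢c v≢c v≢c' w≢c w≢c')

module _ (χ : Coloring 3) where
  open Grid {2593} χ
  open Grid₃ {2593} χ

  corner : ℕ → ℕ → Fin 3
  corner p x = χ x (x + p)

  squares⇒monoL : ∀ {c c' p} xs → c' ≢ c → AllPairs _<_ xs → All (Square c c' p) xs →
                  72 < length xs → MonoL 2593 3 χ
  squares⇒monoL {c} {c'} {p} xs c'≢c sorted squares 72<xs =
    let (_ , ys , sorted′ , squares′ , 1<ys) =
          repeated-gap {m = 1} 73 (proj₁ ∘ proj₁) sorted squares 72<xs (<ᵇ⇒< _ _ _)
    in  two-squares ys sorted′ squares′ 1<ys
    where
    two-squares : ∀ {d} ys → AllPairs _<_ ys →
                  All (λ x → Square c c' p x × Square c c' p (x + suc d)) ys → 1 < length ys →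
                  MonoL 2593 3 χ
    two-squares (a ∷ b ∷ _) ((a<b ∷ _) ∷ _) ((sa , sa′) ∷ (sb , sb′) ∷ _) _ =
      four-squares⇒monoL c'≢c (s≤s z≤n) a<b sa sa′ sb sb′
    two-squares (_ ∷ []) _ _ (s≤s ())

  diagonal-pairs⇒monoL : ∀ {c p} ys → 1 ≤ p → AllPairs _<_ ys →
                         All (λ x → Diagonal c x × Diagonal c (x + p)) ys → 144 < length ys →
                         MonoL 2593 3 χ
  diagonal-pairs⇒monoL {c} {p} ys 1≤p sorted diagonal 144<ys
    with any? (λ x → corner p x ≟ᶠ c) ys
  ... | yes found =
    let ((_ , x↘) , (x+p<N , x+p↘)) , x↗ = All.lookupAny diagonal found
    in  monoL-diagonal (m<m+n _ 1≤p) x+p<N (trans x↘ (sym x↗)) (trans x↗ (sym x+p↘))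
  ... | no none =
    let (c' , c'∈ , 72<fibre) =
          pigeonhole _≟ᶠ_ (corner p) (others c) (All.map ∈-others⁺ (¬Any⇒All¬ ys none))
                     (subst (λ l → l * 72 < length ys) (sym (length-others c)) 144<ys)
    in  squares⇒monoL (fibre _≟ᶠ_ (corner p) c' ys) (∈-others⁻ c'∈)
          (AllPairs-fibre⁺ _≟ᶠ_ (corner p) sorted)
          (All.map (λ ((dx , dx+p) , x↗) → dx , dx+p , x↗) (All-fibre⁺ _≟ᶠ_ (corner p) diagonal))
          72<fibre

  diagonal⇒monoL : ∀ {c} xs → AllPairs _<_ xs → All (Diagonal c) xs → 864 < length xs →
                   MonoL 2593 3 χ
  diagonal⇒monoL xs sorted diagonal 864<xs =
    let (_ , ys , sorted′ , diagonal′ , 144<ys) =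
          repeated-gap {m = 144} 865 proj₁ sorted diagonal 864<xs (<ᵇ⇒< _ _ _)
    in  diagonal-pairs⇒monoL ys (s≤s z≤n) sorted′ diagonal′ 144<ys

theorem2p3 : EveryColoringHasMonoL 2593 3
theorem2p3 χ =
  let (c , _ , 864<fibre) =
        pigeonhole _≟ᶠ_ diagonal (allFin 3) (All.universal (∈-allFin ∘ diagonal) (upTo 2593))
                   (subst (2592 <_) (sym (length-upTo 2593)) ≤-refl)
  in  diagonal⇒monoL χ (fibre _≟ᶠ_ diagonal c (upTo 2593))
        (AllPairs-fibre⁺ _≟ᶠ_ diagonal (AllPairs.applyUpTo⁺₁ id 2593 (λ i<j _ → i<j)))
        (All-fibre⁺ _≟ᶠ_ diagonal (all-upTo 2593))
        864<fibre
  where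
  diagonal : ℕ → Fin 3
  diagonal x = χ x x
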